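{- Let $G$ be a connected graph of order $n$, and let $H$ be a maximal $2$-connected subgraph of $G$ of order at least $3$. Let $x$ be a vertex of $H$ such that the set of all neighbors of $x$ induces a complete subgraph of $H$. Then $av(G,x)\leq (n-1)/2$, with equality if and only if $G=K_3$.
   Context: A set of vertices is a connected set if it induces a connected subgraph. $G-x$ is the subgraph induced by $V(G)\setminus\{x\}$; $\mathcal C(G-x)$ is the collection of nonempty connected sets of $G-x$; $\mathcal C(G,x)$ is the collection of connected sets of $G$ containing $x$. Definition of $av(G,x)$: fix a shortest distance spanning tree $T$ of $G$ rooted at $x$ (for each vertex $v$, the path in $T$ from $v$ to $x$ has length equal to the distance from $v$ to $x$ in $G$). For each $U\in\mathcal C(G-x)$ choose a vertex $v_U\in U$ closest to $x$, and let $p_U$ be the path in $T$ between $v_U$ and $x$, regarded as its vertex set; $|p_U|$ denotes its length (number of edges). Let $\overline U=U\cup p_U$. For $Q\in\mathcal C(G,x)$ let $W(Q)=\{U\in\mathcal C(G-x):\overline U=Q\}$, ordered by $U\preceq U'$ iff $p_{U'}\subseteq p_U$; when $W(Q)\ne\emptyset$ let $U_Q$ be the minimal element of $W(Q)$. Let $\mathcal M(G-x)=\{U_Q: Q\in\mathcal C(G,x),\ W(Q)\neq\emptyset\}$ and $av(G,x)=\frac{1}{|\mathcal M(G-x)|}\sum_{U\in\mathcal M(G-x)}|p_U|$. -}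

module Defs where

open import Level using (0ℓ)
open import Data.Nat using (ℕ; zero; suc; _+_; _*_; _∸_; _≤_)
open import Data.Fin using (Fin)
open import Data.Fin.Subset using (Subset; _∈_; _∉_; _⊆_; ∣_∣)
open import Data.Product using (Σ; ∃; _×_; _,_)
open import Data.Sum using (_⊎_)
open import Data.List using (List; map; length)
open import Data.Nat.ListAction using (sum)
open import Data.Unit using (⊤)
open import Relation.Nullary using (¬_)
open import Relation.Binary.PropositionalEquality using (_≡_; _≢_)
open import Function.Bundles using (_⇔_)
import Data.List.Membership.Propositional as LM
open import Data.List.Relation.Unary.Unique.Propositional using (Unique)

record Graph (n : ℕ) : Set₁ where
  field
    Adj    : Fin n → Fin n → Set
    sym    : ∀ {u v} → Adj u v → Adj v u
    irrefl : ∀ {u} → ¬ Adj u u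
open Graph public

module _ {n : ℕ} (G : Graph n) where

  data Walk (P : Fin n → Set) : Fin n → Fin n → Set where
    here : ∀ {u} → P u → Walk P u u
    step : ∀ {u w v} → P u → Adj G u w → Walk P w v → Walk P u v

  walkLength : ∀ {P u v} → Walk P u v → ℕ
  walkLength (here _) = 0
  walkLength (step _ _ w) = suc (walkLength w)

  ConnectedP : (Fin n → Set) → Set
  ConnectedP P = ∀ u v → P u → P v → Walk P u v

  AllV : Fin n → Set
  AllV _ = ⊤

  ConnectedGraph : Set
  ConnectedGraph = ConnectedP AllV

  TwoConnected : Subset n → Set
  TwoConnected S = (3 ≤ ∣ S ∣) × ConnectedP (_∈ S)
                 × (∀ v → v ∈ S → ConnectedP (λ w → w ∈ S × w ≢ v))

  MaximalTwoConnected : Subset n → Set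
  MaximalTwoConnected S = TwoConnected S × (∀ S' → S ⊆ S' → TwoConnected S' → S' ≡ S)

  -- shortest distance spanning tree rooted at x, given by parent pointers and depths:
  -- depth v is the length of the tree path from v to x and equals dist_G(v,x)
  record SDTree (x : Fin n) : Set where
    field
      parent   : Fin n → Fin n
      depth    : Fin n → ℕ
      depth-x  : depth x ≡ 0
      par-adj  : ∀ v → v ≢ x → Adj G v (parent v)
      par-dep  : ∀ v → v ≢ x → depth v ≡ suc (depth (parent v))
      shortest : ∀ v (w : Walk AllV v x) → depth v ≤ walkLength w

  module _ {x : Fin n} (T : SDTree x) where
    open SDTree T

    data OnPath (v : Fin n) : Fin n → Set where
      on-here : OnPath v v
      on-up   : ∀ {w} → v ≢ x → OnPath (parent v) w → OnPath v w

  InC-x : Fin n → Subset n → Set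
  InC-x x U = (∃ λ u → u ∈ U) × x ∉ U × ConnectedP (_∈ U)

  InCx : Fin n → Subset n → Set
  InCx x Q = x ∈ Q × ConnectedP (_∈ Q)

  module _ {x : Fin n} (T : SDTree x) (vU : Subset n → Fin n) where
    open SDTree T

    ClosestChoice : Set
    ClosestChoice = ∀ U → InC-x x U → vU U ∈ U × (∀ u → u ∈ U → depth (vU U) ≤ depth u)

    pU : Subset n → Fin n → Set
    pU U = OnPath T (vU U)

    BarEq : Subset n → Subset n → Set
    BarEq U Q = ∀ w → (w ∈ Q) ⇔ (w ∈ U ⊎ pU U w)

    Prec : Subset n → Subset n → Set
    Prec U U' = ∀ w → pU U' w → pU U w

    -- U ∈ ℳ(G - x): U = U_Q, the minimal (least) element of W(Q), for some Q ∈ 𝒞(G,x)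
    InM : Subset n → Set
    InM U = InC-x x U × Σ (Subset n) λ Q → InCx x Q × BarEq U Q
            × (∀ U' → InC-x x U' → BarEq U' Q → Prec U U')

    pLen : Subset n → ℕ
    pLen U = depth (vU U)

    EnumM : List (Subset n) → Set
    EnumM L = Unique L × (∀ U → (U LM.∈ L) ⇔ InM U)

  IsK3 : Set
  IsK3 = (n ≡ 3) × (∀ u v → u ≢ v → Adj G u v)

-- For U ∈ ℳ(G − x) write k(U) = |p_U| ≥ 1. If k(U) ≥ 2, let w be the depth-1 vertex of p_U and
-- a ≠ w another neighbour of x (it exists because H is 2-connected), so that a ~ w as N(x) is a
-- clique. Then U ∪ (p_U − x) ∪ {a} is connected, avoids x and has closest vertices at depth 1, so
-- it lies in ℳ with k = 1; removing a and adding x gives back Ū, and minimality in W(Ū) makes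
-- this map injective. It never hits {w₀} for a fixed neighbour w₀ of x, so fewer members of ℳ
-- have k ≥ 2 than k = 1. As p_U and a are k(U) + 2 distinct vertices, k(U) ≤ n − 2, and
-- averaging gives 2 Σ k ≤ (n − 1) |ℳ|, with equality only if n = 3.

module Submission where

open import Data.Nat using (ℕ; zero; suc; _+_; _*_; _∸_; _≤_; _<_; z≤n; s≤s; s≤s⁻¹; _≤?_)
open import Data.Nat.Properties
open import Data.Nat.ListAction using (sum)
open import Data.Nat.Tactic.RingSolver using (solve-∀)
open import Data.Fin using (Fin; toℕ)
import Data.Fin as Fin
open import Data.Fin.Properties using (any?; injective⇒≤; toℕ-injective; toℕ≤pred[n])
open import Data.Fin.Subset using (Subset; _∈_; _∉_; _⊆_; ⁅_⁆; _∪_; ⊥; ∣_∣; inside; outside)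
open import Data.Fin.Subset.Properties
  using (x∈⁅x⁆; x∈⁅y⁆⇒x≡y; ∉⊥; x∈p∪q⁺; x∈p∪q⁻; ⊆-antisym; _∈?_; p⊆q⇒∣p∣≤∣q∣; ∣⁅x⁆∣≡1; ∣p∣≤n)
open import Data.List using (List; []; _∷_; map; length; filter)
open import Data.Vec using ([]; _∷_)
open import Data.List.Properties using (length-removeAt′; length-map; length-tabulate)
open import Data.List.Relation.Unary.Any using (here; there)
import Data.List.Relation.Unary.All as All
open import Data.List.Relation.Unary.All using ([]; _∷_)
open import Data.List.Relation.Unary.All.Properties using (map⁺)
open import Data.List.Relation.Unary.AllPairs using (_∷_)
open import Data.List.Relation.Unary.Unique.Propositional using (Unique; [])
open import Data.List.Relation.Unary.Unique.Propositional.Properties using (filter⁺)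
import Data.List.Membership.Propositional as List
open import Data.List.Membership.Propositional.Properties using (∈-map⁻; ∈-filter⁺; ∈-filter⁻; ∈-allFin)
open import Data.Product using (Σ; ∃; _×_; _,_; proj₁; proj₂)
open import Data.Sum using (_⊎_; inj₁; inj₂)
open import Data.Empty using (⊥-elim)
open import Data.Unit using (tt)
open import Function using (_∘_)
open import Function.Bundles using (_⇔_; mk⇔; Equivalence)
import Function.Properties.Equivalence as ⇔
open import Relation.Nullary using (¬_; yes; no)
open import Relation.Nullary.Decidable using (_×-dec_; ¬?)
open import Relation.Unary using (Decidable)
open import Relation.Unary.Properties using (∁?)
open import Relation.Binary.PropositionalEquality
open import Defs hiding (sym)

∈-─⁺ : ∀ {A : Set} {a b : A} {ys} (p : a List.∈ ys) → b List.∈ ys → b ≢ a → b List.∈ ys List.─ p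
∈-─⁺ (here refl) (here refl) b≢a = ⊥-elim (b≢a refl)
∈-─⁺ (here _)    (there q)   _   = q
∈-─⁺ (there p)   (here e)    _   = here e
∈-─⁺ (there p)   (there q)   b≢a = there (∈-─⁺ p q b≢a)

Unique-⊆⇒length≤ : ∀ {A : Set} {xs ys : List A} → Unique xs
  → (∀ {a} → a List.∈ xs → a List.∈ ys) → length xs ≤ length ys
Unique-⊆⇒length≤ {xs = []} _ _ = z≤n
Unique-⊆⇒length≤ {xs = a ∷ xs} {ys} (a∉xs ∷ !xs) xs⊆ys =
  subst (suc (length xs) ≤_) (sym (length-removeAt′ ys _))
    (s≤s (Unique-⊆⇒length≤ !xs λ b∈xs →
      ∈-─⁺ a∈ys (xs⊆ys (there b∈xs)) (≢-sym (All.lookup a∉xs b∈xs))))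
  where a∈ys = xs⊆ys (here refl)

module _ {A B : Set} (f : A → B) where

  map⁺-injectiveOn : ∀ {xs} → Unique xs
    → (∀ {a a'} → a List.∈ xs → a' List.∈ xs → f a ≡ f a' → a ≡ a') → Unique (map f xs)
  map⁺-injectiveOn [] _ = []
  map⁺-injectiveOn (a∉xs ∷ !xs) inj =
    map⁺ (All.tabulate λ a'∈xs e → All.lookup a∉xs a'∈xs (inj (here refl) (there a'∈xs) e))
    ∷ map⁺-injectiveOn !xs (λ p q → inj (there p) (there q))

  injection-length< : ∀ {xs ys} {b : B} → Unique xs
    → (∀ {a} → a List.∈ xs → f a List.∈ ys)
    → (∀ {a a'} → a List.∈ xs → a' List.∈ xs → f a ≡ f a' → a ≡ a')
    → b List.∈ ys → (∀ {a} → a List.∈ xs → f a ≢ b)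
    → length xs < length ys
  injection-length< {xs} {ys} {b} !xs maps inj b∈ys b∉img =
    subst (_≤ length ys) (cong suc (length-map f xs))
      (Unique-⊆⇒length≤ {xs = b ∷ map f xs}
        (map⁺ (All.tabulate (≢-sym ∘ b∉img)) ∷ map⁺-injectiveOn !xs inj) ⊆ys)
    where
    ⊆ys : ∀ {c} → c List.∈ b ∷ map f xs → c List.∈ ys
    ⊆ys (here refl) = b∈ys
    ⊆ys (there c∈) with a , a∈xs , refl ← ∈-map⁻ f c∈ = maps a∈xs

sum-map-≡1 : ∀ {A : Set} (g : A → ℕ) xs → (∀ {a} → a List.∈ xs → g a ≡ 1) → sum (map g xs) ≡ length xs
sum-map-≡1 g []       _    = refl
sum-map-≡1 g (a ∷ xs) g≡1 = cong₂ _+_ (g≡1 (here refl)) (sum-map-≡1 g xs (g≡1 ∘ there))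

private
  absorbˡ : ∀ c d p q → c + (c * p + d * q) ≡ c * suc p + d * q
  absorbˡ = solve-∀

  absorbʳ : ∀ c d p q → d + (c * p + d * q) ≡ c * p + d * suc q
  absorbʳ = solve-∀

module _ {A : Set} {P : A → Set} (P? : Decidable P) where

  length-filter+filter-∁ : ∀ xs → length xs ≡ length (filter P? xs) + length (filter (∁? P?) xs)
  length-filter+filter-∁ [] = refl
  length-filter+filter-∁ (a ∷ xs) with P? a
  ... | yes _ = cong suc (length-filter+filter-∁ xs)
  ... | no _  = trans (cong suc (length-filter+filter-∁ xs)) (sym (+-suc _ _))

  sum-≤-filter : ∀ (g : A → ℕ) {c d} xs
    → (∀ {a} → a List.∈ xs → P a → g a ≤ c) → (∀ {a} → a List.∈ xs → ¬ P a → g a ≤ d)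
    → sum (map g xs) ≤ c * length (filter P? xs) + d * length (filter (∁? P?) xs)
  sum-≤-filter g [] _ _ = z≤n
  sum-≤-filter g {c} {d} (a ∷ xs) onP off¬P with P? a
    | sum-≤-filter g xs (onP ∘ there) (off¬P ∘ there)
  ... | yes p | ih = ≤-trans (+-mono-≤ (onP (here refl) p) ih) (≤-reflexive (absorbˡ c d _ _))
  ... | no ¬p | ih = ≤-trans (+-mono-≤ (off¬P (here refl) ¬p) ih) (≤-reflexive (absorbʳ c d _ _))

private
  slack-identity : ∀ m a e → suc (suc m) * (a + (a + e)) ≡ 2 * (suc m * a + (a + e)) + m * e
  slack-identity = solve-∀

doubled-sum-bound : ∀ m s a e → s ≤ suc m * a + (a + e)
  → 2 * s + m * e ≤ suc (suc m) * (a + (a + e))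
doubled-sum-bound m s a e s≤ = begin
  2 * s + m * e                  ≤⟨ +-monoˡ-≤ (m * e) (*-monoʳ-≤ 2 s≤) ⟩
  2 * (suc m * a + (a + e)) + m * e ≡⟨ slack-identity m a e ⟨
  suc (suc m) * (a + (a + e))    ∎
  where open ≤-Reasoning

average-bound : ∀ n s a b → 3 ≤ n → s ≤ (n ∸ 2) * a + b → a < b
  → (2 * s ≤ (n ∸ 1) * (a + b)) × (2 * s ≡ (n ∸ 1) * (a + b) → n ≡ 3)
average-bound n s a b 3≤n s≤ a<b
  with m , refl ← m≤n⇒∃[o]m+o≡n 3≤n | e , refl ← m≤n⇒∃[o]m+o≡n (<⇒≤ a<b)
  = ≤-trans (m≤m+n (2 * s) (m * e)) bound , tight
  where
  bound = doubled-sum-bound m s a e s≤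
  tight : 2 * s ≡ suc (suc m) * (a + (a + e)) → 3 + m ≡ 3
  tight eq with m*n≡0⇒m≡0∨n≡0 m (n≤0⇒n≡0 (+-cancelˡ-≤ (2 * s) _ 0
                  (subst (2 * s + m * e ≤_) (trans (sym eq) (sym (+-identityʳ _))) bound)))
  ... | inj₁ refl = refl
  ... | inj₂ refl = ⊥-elim (<-irrefl (sym (+-identityʳ a)) a<b)

module _ {n : ℕ} {G : Graph n} where

  walk-map : ∀ {P Q : Fin n → Set} {u v} → (∀ {t} → P t → Q t) → Walk G P u v → Walk G Q u v
  walk-map f (here p)     = here (f p)
  walk-map f (step p a w) = step (f p) a (walk-map f w)

  _++ʷ_ : ∀ {P u v w} → Walk G P u v → Walk G P v w → Walk G P u w
  here _     ++ʷ w' = w'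
  step p a w ++ʷ w' = step p a (w ++ʷ w')

  walk-source : ∀ {P u v} → Walk G P u v → P u
  walk-source (here p)     = p
  walk-source (step p _ _) = p

  walk-reverse : ∀ {P u v} → Walk G P u v → Walk G P v u
  walk-reverse (here p)     = here p
  walk-reverse (step p a w) = walk-reverse w ++ʷ step (walk-source w) (Graph.sym G a) (here p)

  connected-via : ∀ {P : Fin n → Set} h → (∀ t → P t → Walk G P t h) → ConnectedP G P
  connected-via h to-h u v pu pv = to-h u pu ++ʷ walk-reverse (to-h v pv)

  walk-first-step : ∀ {P u v} → Walk G P u v → u ≢ v → ∃ λ t → Adj G u t × P t
  walk-first-step (here _)      u≢u = ⊥-elim (u≢u refl)
  walk-first-step (step _ a w) _   = _ , a , walk-source w

∣p∪q∣≤∣p∣+∣q∣ : ∀ {n} (p q : Subset n) → ∣ p ∪ q ∣ ≤ ∣ p ∣ + ∣ q ∣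
∣p∪q∣≤∣p∣+∣q∣ []            []            = z≤n
∣p∪q∣≤∣p∣+∣q∣ (inside ∷ p)  (inside ∷ q)  = s≤s (≤-trans (∣p∪q∣≤∣p∣+∣q∣ p q) (+-monoʳ-≤ ∣ p ∣ (n≤1+n _)))
∣p∪q∣≤∣p∣+∣q∣ (inside ∷ p)  (outside ∷ q) = s≤s (∣p∪q∣≤∣p∣+∣q∣ p q)
∣p∪q∣≤∣p∣+∣q∣ (outside ∷ p) (inside ∷ q)  = ≤-trans (s≤s (∣p∪q∣≤∣p∣+∣q∣ p q)) (≤-reflexive (sym (+-suc ∣ p ∣ ∣ q ∣)))
∣p∪q∣≤∣p∣+∣q∣ (outside ∷ p) (outside ∷ q) = ∣p∪q∣≤∣p∣+∣q∣ p q

∈∪⁅⁆⁻ : ∀ {n} {U : Subset n} {t y} → t ∈ U ∪ ⁅ y ⁆ → t ∈ U ⊎ t ≡ y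
∈∪⁅⁆⁻ {U = U} {y = y} t∈ with x∈p∪q⁻ U ⁅ y ⁆ t∈
... | inj₁ t∈U   = inj₁ t∈U
... | inj₂ t∈⁅y⁆ = inj₂ (x∈⁅y⁆⇒x≡y y t∈⁅y⁆)

third-element : ∀ {n} (S : Subset n) → 3 ≤ ∣ S ∣ → ∀ p q → ∃ λ u → u ∈ S × u ≢ p × u ≢ q
third-element S 3≤∣S∣ p q
  with any? (λ u → (u ∈? S) ×-dec (¬? (u Fin.≟ p) ×-dec ¬? (u Fin.≟ q)))
... | yes found = found
... | no none = ⊥-elim (1+n≰n (begin
      3                     ≤⟨ 3≤∣S∣ ⟩
      ∣ S ∣                 ≤⟨ p⊆q⇒∣p∣≤∣q∣ S⊆pq ⟩
      ∣ ⁅ p ⁆ ∪ ⁅ q ⁆ ∣     ≤⟨ ∣p∪q∣≤∣p∣+∣q∣ ⁅ p ⁆ ⁅ q ⁆ ⟩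
      ∣ ⁅ p ⁆ ∣ + ∣ ⁅ q ⁆ ∣ ≡⟨ cong₂ _+_ (∣⁅x⁆∣≡1 p) (∣⁅x⁆∣≡1 q) ⟩
      2                     ∎))
  where
  open ≤-Reasoning
  S⊆pq : S ⊆ ⁅ p ⁆ ∪ ⁅ q ⁆
  S⊆pq {u} u∈S with u Fin.≟ p | u Fin.≟ q
  ... | yes refl | _        = x∈p∪q⁺ (inj₁ (x∈⁅x⁆ u))
  ... | no _     | yes refl = x∈p∪q⁺ (inj₂ (x∈⁅x⁆ u))
  ... | no u≢p   | no u≢q   = ⊥-elim (none (u , u∈S , u≢p , u≢q))

covered-by-three : ∀ {n} {p q r : Fin n} → n ≤ 3 → p ≢ q → p ≢ r → q ≢ r
  → ∀ t → t ≡ p ⊎ t ≡ q ⊎ t ≡ r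
covered-by-three {n} {p} {q} {r} n≤3 p≢q p≢r q≢r t with t Fin.≟ p | t Fin.≟ q | t Fin.≟ r
... | yes t≡p | _       | _       = inj₁ t≡p
... | no _    | yes t≡q | _       = inj₂ (inj₁ t≡q)
... | no _    | no _    | yes t≡r = inj₂ (inj₂ t≡r)
... | no t≢p  | no t≢q  | no t≢r  = ⊥-elim (1+n≰n (≤-trans four≤n n≤3))
  where
  four≤n : 4 ≤ n
  four≤n = subst (4 ≤_) (length-tabulate (λ i → i))
    (Unique-⊆⇒length≤ {xs = p ∷ q ∷ r ∷ t ∷ []}
      ((p≢q ∷ p≢r ∷ ≢-sym t≢p ∷ []) ∷ (q≢r ∷ ≢-sym t≢q ∷ []) ∷ (≢-sym t≢r ∷ []) ∷ [] ∷ [])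
      (λ _ → ∈-allFin _))

triangle⇒K3 : ∀ {n} (G : Graph n) {p q r} → n ≡ 3 → Adj G p q → Adj G p r → Adj G q r → IsK3 G
triangle⇒K3 G {p} {q} {r} refl p~q p~r q~r = refl , complete
  where
  distinct : ∀ {u v} → Adj G u v → u ≢ v
  distinct u~v refl = irrefl G u~v
  cover = covered-by-three ≤-refl (distinct p~q) (distinct p~r) (distinct q~r)
  complete : ∀ u v → u ≢ v → Adj G u v
  complete u v u≢v with cover u | cover v
  ... | inj₁ refl        | inj₂ (inj₁ refl) = p~q
  ... | inj₁ refl        | inj₂ (inj₂ refl) = p~r
  ... | inj₂ (inj₁ refl) | inj₁ refl        = Graph.sym G p~q
  ... | inj₂ (inj₁ refl) | inj₂ (inj₂ refl) = q~r
  ... | inj₂ (inj₂ refl) | inj₁ refl        = Graph.sym G p~r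
  ... | inj₂ (inj₂ refl) | inj₂ (inj₁ refl) = Graph.sym G q~r
  ... | inj₁ refl        | inj₁ refl        = ⊥-elim (u≢v refl)
  ... | inj₂ (inj₁ refl) | inj₂ (inj₁ refl) = ⊥-elim (u≢v refl)
  ... | inj₂ (inj₂ refl) | inj₂ (inj₂ refl) = ⊥-elim (u≢v refl)

module _ {n : ℕ} (G : Graph n) {S : Subset n} (S-2conn : TwoConnected G S) {x : Fin n} (x∈S : x ∈ S) where

  private
    3≤∣S∣ = proj₁ S-2conn
    S-conn = proj₁ (proj₂ S-2conn)
    S-no-cut = proj₂ (proj₂ S-2conn)

  block-neighbour : ∃ λ w → Adj G x w
  block-neighbour with u , u∈S , u≢x , _ ← third-element S 3≤∣S∣ x x
    with w , x~w , _ ← walk-first-step (S-conn x u x∈S u∈S) (u≢x ∘ sym)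
    = w , x~w

  -- A walk from x to a third vertex of S avoiding w leaves x through a neighbour other than w.
  block-other-neighbour : ∀ w → w ∈ S → w ≢ x → ∃ λ a → Adj G x a × a ≢ w
  block-other-neighbour w w∈S w≢x with u , u∈S , u≢x , u≢w ← third-element S 3≤∣S∣ x w
    with a , x~a , _ , a≢w ← walk-first-step (S-no-cut w w∈S x u (x∈S , w≢x ∘ sym) (u∈S , u≢w)) (u≢x ∘ sym)
    = a , x~a , a≢w

  block-partner : (∀ u → Adj G x u → u ∈ S)
    → Σ (Fin n → Fin n) λ partner → ∀ w → Adj G x w → Adj G x (partner w) × partner w ≢ w
  block-partner N[x]⊆S = proj₁ ∘ choice , proj₂ ∘ choice
    where
    choice : ∀ w → Σ (Fin n) λ a → Adj G x w → Adj G x a × a ≢ w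
    choice w with w ∈? S | w Fin.≟ x
    ... | yes w∈S | no w≢x  = let a , x~a , a≢w = block-other-neighbour w w∈S w≢x in a , λ _ → x~a , a≢w
    ... | yes _   | yes refl = w , λ x~x → ⊥-elim (irrefl G x~x)
    ... | no w∉S  | _        = w , λ x~w → ⊥-elim (w∉S (N[x]⊆S w x~w))

module _ {n : ℕ} {G : Graph n} {x : Fin n} (T : SDTree G x) where
  open SDTree T

  depth≡0⇒root : ∀ {t} → depth t ≡ 0 → t ≡ x
  depth≡0⇒root {t} d≡0 with t Fin.≟ x
  ... | yes t≡x = t≡x
  ... | no t≢x with () ← trans (sym d≡0) (par-dep t t≢x)

  0<depth⇒≢root : ∀ {t} → 0 < depth t → t ≢ x
  0<depth⇒≢root 0<d refl rewrite depth-x with () ← 0<d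

  depth≡suc⇒≢root : ∀ {t d} → depth t ≡ suc d → t ≢ x
  depth≡suc⇒≢root d≡ = 0<depth⇒≢root (subst (0 <_) (sym d≡) (s≤s z≤n))

  ≢root⇒0<depth : ∀ {t} → t ≢ x → 0 < depth t
  ≢root⇒0<depth {t} t≢x rewrite par-dep t t≢x = s≤s z≤n

  depth-parent : ∀ {t} → t ≢ x → depth (parent t) ≡ depth t ∸ 1
  depth-parent {t} t≢x = cong (_∸ 1) (sym (par-dep t t≢x))

  depth≡1⇒parent≡root : ∀ {a} → depth a ≡ 1 → parent a ≡ x
  depth≡1⇒parent≡root d≡1 =
    depth≡0⇒root (trans (depth-parent (depth≡suc⇒≢root d≡1)) (cong (_∸ 1) d≡1))

  neighbour⇒depth≡1 : ∀ {a} → Adj G x a → depth a ≡ 1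
  neighbour⇒depth≡1 {a} x~a = ≤-antisym
    (shortest a (step tt (Graph.sym G x~a) (here tt)))
    (≢root⇒0<depth λ { refl → irrefl G x~a })

  depth≡1⇒neighbour : ∀ {a} → depth a ≡ 1 → Adj G x a
  depth≡1⇒neighbour {a} d≡1 = Graph.sym G
    (subst (Adj G a) (depth≡1⇒parent≡root d≡1) (par-adj a (depth≡suc⇒≢root d≡1)))

  parent-depth< : ∀ {t} → t ≢ x → depth (parent t) < depth t
  parent-depth< {t} t≢x rewrite par-dep t t≢x = ≤-refl

  OnPath-depth≤ : ∀ {v t} → OnPath G T v t → depth t ≤ depth v
  OnPath-depth≤ on-here          = ≤-refl
  OnPath-depth≤ (on-up v≢x v↝t) = ≤-trans (OnPath-depth≤ v↝t) (<⇒≤ (parent-depth< v≢x))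

  OnPath-depth-injective : ∀ {v t t'} → OnPath G T v t → OnPath G T v t' → depth t ≡ depth t' → t ≡ t'
  OnPath-depth-injective on-here on-here _ = refl
  OnPath-depth-injective on-here (on-up v≢x v↝t') d≡ =
    ⊥-elim (<⇒≢ (≤-<-trans (OnPath-depth≤ v↝t') (parent-depth< v≢x)) (sym d≡))
  OnPath-depth-injective (on-up v≢x v↝t) on-here d≡ =
    ⊥-elim (<⇒≢ (≤-<-trans (OnPath-depth≤ v↝t) (parent-depth< v≢x)) d≡)
  OnPath-depth-injective (on-up _ v↝t) (on-up _ v↝t') d≡ = OnPath-depth-injective v↝t v↝t' d≡

  OnPath-trans : ∀ {v t s} → OnPath G T v t → OnPath G T t s → OnPath G T v s
  OnPath-trans on-here          t↝s = t↝s
  OnPath-trans (on-up v≢x v↝t) t↝s = on-up v≢x (OnPath-trans v↝t t↝s)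

  OnPath-parent : ∀ {v t} → OnPath G T v t → t ≢ x → OnPath G T v (parent t)
  OnPath-parent v↝t t≢x = OnPath-trans v↝t (on-up t≢x on-here)

  OnPath-root : ∀ v → OnPath G T v x
  OnPath-root v = go (depth v) v refl
    where
    go : ∀ d v → depth v ≡ d → OnPath G T v x
    go d v d≡ with v Fin.≟ x
    go _       v _  | yes refl = on-here
    go zero    v d≡ | no v≢x = ⊥-elim (v≢x (depth≡0⇒root d≡))
    go (suc d) v d≡ | no v≢x = on-up v≢x (go d (parent v) (trans (depth-parent v≢x) (cong (_∸ 1) d≡)))

  OnPath-from-root : ∀ {t} → OnPath G T x t → t ≡ x
  OnPath-from-root on-here          = refl
  OnPath-from-root (on-up x≢x _) = ⊥-elim (x≢x refl)

  OnPath-depth≡1 : ∀ {v t} → depth v ≡ 1 → OnPath G T v t → t ≡ v ⊎ t ≡ x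
  OnPath-depth≡1 _   on-here          = inj₁ refl
  OnPath-depth≡1 d≡1 (on-up v≢x p↝t) =
    inj₂ (OnPath-from-root (subst (λ p → OnPath G T p _) (depth≡1⇒parent≡root d≡1) p↝t))

  OnPath⁻ : Fin n → Fin n → Set
  OnPath⁻ v s = OnPath G T v s × s ≢ x

  ancestor : ℕ → Fin n → Fin n
  ancestor zero    v = v
  ancestor (suc j) v = ancestor j (parent v)

  ancestor-OnPath : ∀ j v → j ≤ depth v → OnPath G T v (ancestor j v)
  ancestor-OnPath zero    v _ = on-here
  ancestor-OnPath (suc j) v j<d = on-up v≢x
    (ancestor-OnPath j (parent v) (subst (j ≤_) (sym (depth-parent v≢x)) (∸-monoˡ-≤ 1 j<d)))
    where v≢x = 0<depth⇒≢root (≤-trans (s≤s z≤n) j<d)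

  depth-ancestor : ∀ j v → j ≤ depth v → depth (ancestor j v) ≡ depth v ∸ j
  depth-ancestor zero    v _ = refl
  depth-ancestor (suc j) v j<d with v≢x ← 0<depth⇒≢root (≤-trans (s≤s z≤n) j<d)
    rewrite par-dep v v≢x = depth-ancestor j (parent v) (s≤s⁻¹ j<d)

  entry : Fin n → Fin n
  entry v = ancestor (depth v ∸ 1) v

  entry-OnPath : ∀ v → OnPath G T v (entry v)
  entry-OnPath v = ancestor-OnPath (depth v ∸ 1) v (m∸n≤m _ 1)

  depth-entry : ∀ {v} → v ≢ x → depth (entry v) ≡ 1
  depth-entry {v} v≢x = trans (depth-ancestor (depth v ∸ 1) v (m∸n≤m _ 1)) (m∸[m∸n]≡n (≢root⇒0<depth v≢x))

  entry-neighbour : ∀ {v} → v ≢ x → Adj G x (entry v)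
  entry-neighbour = depth≡1⇒neighbour ∘ depth-entry

  walk-up : ∀ j v → depth v ≡ suc j → Walk G (OnPath⁻ v) v (ancestor j v)
  walk-up zero    v d≡ = here (on-here , depth≡suc⇒≢root d≡)
  walk-up (suc j) v d≡ = step (on-here , v≢x) (par-adj v v≢x)
    (walk-map (λ (p↝s , s≢x) → on-up v≢x p↝s , s≢x)
      (walk-up j (parent v) (trans (depth-parent v≢x) (cong (_∸ 1) d≡))))
    where v≢x = depth≡suc⇒≢root d≡

  walk-to-entry : ∀ {v} → v ≢ x → Walk G (OnPath⁻ v) v (entry v)
  walk-to-entry {v} v≢x = subst (λ j → Walk G (OnPath⁻ v) v (ancestor j v)) (cong (_∸ 1) d≡)
                            (walk-up (depth v ∸ 1) v (sym d≡))
    where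
    d≡ : suc (depth v ∸ 1) ≡ depth v
    d≡ = m+[n∸m]≡n (≢root⇒0<depth v≢x)

  ancestorSet : ℕ → Fin n → Subset n
  ancestorSet zero    _ = ⊥
  ancestorSet (suc d) v = ⁅ v ⁆ ∪ ancestorSet d (parent v)

  pathSet : Fin n → Subset n
  pathSet v = ancestorSet (depth v) v

  private
    ancestorSet-sound : ∀ d v {t} → depth v ≡ d → t ∈ ancestorSet d v → OnPath⁻ v t
    ancestorSet-sound zero    _ _  t∈ = ⊥-elim (∉⊥ t∈)
    ancestorSet-sound (suc d) v d≡ t∈ with v≢x ← depth≡suc⇒≢root d≡
      with x∈p∪q⁻ ⁅ v ⁆ _ t∈
    ... | inj₁ t∈⁅v⁆ rewrite x∈⁅y⁆⇒x≡y v t∈⁅v⁆ = on-here , v≢x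
    ... | inj₂ t∈rest
      with p↝t , t≢x ← ancestorSet-sound d (parent v) (trans (depth-parent v≢x) (cong (_∸ 1) d≡)) t∈rest
      = on-up v≢x p↝t , t≢x

    ancestorSet-complete : ∀ d v {t} → depth v ≡ d → OnPath⁻ v t → t ∈ ancestorSet d v
    ancestorSet-complete zero    v d≡ (on-here , v≢x)   = ⊥-elim (v≢x (depth≡0⇒root d≡))
    ancestorSet-complete zero    v d≡ (on-up v≢x _ , _) = ⊥-elim (v≢x (depth≡0⇒root d≡))
    ancestorSet-complete (suc d) v _  (on-here , _)     = x∈p∪q⁺ (inj₁ (x∈⁅x⁆ v))
    ancestorSet-complete (suc d) v d≡ (on-up v≢x p↝t , t≢x) = x∈p∪q⁺ (inj₂
      (ancestorSet-complete d (parent v) (trans (depth-parent v≢x) (cong (_∸ 1) d≡)) (p↝t , t≢x)))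

  ∈pathSet⇔ : ∀ {v t} → t ∈ pathSet v ⇔ OnPath⁻ v t
  ∈pathSet⇔ = mk⇔ (ancestorSet-sound _ _ refl) (ancestorSet-complete _ _ refl)

module _ {n : ℕ} {G : Graph n} {x : Fin n} (T : SDTree G x)
         {vU : Subset n → Fin n} (closest : ClosestChoice G T vU) where
  open SDTree T

  module _ {U : Subset n} (U∈C : InC-x G x U) where

    vU∈U : vU U ∈ U
    vU∈U = proj₁ (closest U U∈C)

    pLen≤depth : ∀ {t} → t ∈ U → pLen G T vU U ≤ depth t
    pLen≤depth = proj₂ (closest U U∈C) _

    ∈C⇒≢root : ∀ {t} → t ∈ U → t ≢ x
    ∈C⇒≢root t∈U refl = proj₁ (proj₂ U∈C) t∈U

    vU≢root : vU U ≢ x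
    vU≢root = ∈C⇒≢root vU∈U

    0<pLen : 0 < pLen G T vU U
    0<pLen = ≢root⇒0<depth T vU≢root

    pLen≡1 : ∀ {z} → z ∈ U → depth z ≡ 1 → pLen G T vU U ≡ 1
    pLen≡1 z∈U d≡1 = ≤-antisym (subst (pLen G T vU U ≤_) d≡1 (pLen≤depth z∈U)) 0<pLen

  closure : Subset n → Fin n → Set
  closure U t = t ∈ U ⊎ pU G T vU U t

  ℳ-pLen-minimal : ∀ {U U'} → InM G T vU U → InC-x G x U' → (∀ t → closure U t ⇔ closure U' t)
    → pLen G T vU U' ≤ pLen G T vU U
  ℳ-pLen-minimal {U' = U'} (_ , _ , _ , bar , least) U'∈C same-closure =
    OnPath-depth≤ T (least U' U'∈C (λ t → ⇔.trans (bar t) (same-closure t)) (vU U') on-here)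

  module _ {U : Subset n} (U∈C : InC-x G x U) (len≡1 : pLen G T vU U ≡ 1) where

    private
      x∈Q : x ∈ U ∪ ⁅ x ⁆
      x∈Q = x∈p∪q⁺ (inj₂ (x∈⁅x⁆ x))
      U⊆Q : ∀ {t} → t ∈ U → t ∈ U ∪ ⁅ x ⁆
      U⊆Q t∈U = x∈p∪q⁺ (inj₁ t∈U)

    shallow-∪root-connected : ConnectedP G (_∈ U ∪ ⁅ x ⁆)
    shallow-∪root-connected = connected-via x to-x
      where
      to-x : ∀ t → t ∈ U ∪ ⁅ x ⁆ → Walk G (_∈ U ∪ ⁅ x ⁆) t x
      to-x t t∈Q with ∈∪⁅⁆⁻ t∈Q
      ... | inj₂ refl = here t∈Q
      ... | inj₁ t∈U = walk-map U⊆Q (proj₂ (proj₂ U∈C) t (vU U) t∈U (vU∈U U∈C))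
        ++ʷ step (U⊆Q (vU∈U U∈C)) (Graph.sym G (depth≡1⇒neighbour T len≡1)) (here x∈Q)

    shallow-closure : BarEq G T vU U (U ∪ ⁅ x ⁆)
    shallow-closure t = mk⇔ to from
      where
      to : t ∈ U ∪ ⁅ x ⁆ → closure U t
      to t∈Q with ∈∪⁅⁆⁻ t∈Q
      ... | inj₁ t∈U = inj₁ t∈U
      ... | inj₂ refl = inj₂ (OnPath-root T (vU U))
      from : closure U t → t ∈ U ∪ ⁅ x ⁆
      from (inj₁ t∈U) = U⊆Q t∈U
      from (inj₂ v↝t) with OnPath-depth≡1 T len≡1 v↝t
      ... | inj₁ refl = U⊆Q (vU∈U U∈C)
      ... | inj₂ refl = x∈Q

    shallow-closure-injective : ∀ {U'} → InC-x G x U' → pLen G T vU U' ≡ 1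
      → BarEq G T vU U' (U ∪ ⁅ x ⁆) → U' ≡ U
    shallow-closure-injective U'∈C len'≡1 bar' = ⊆-antisym U'⊆U U⊆U'
      where
      U'⊆U : _ ⊆ U
      U'⊆U t∈U' with ∈∪⁅⁆⁻ (Equivalence.from (bar' _) (inj₁ t∈U'))
      ... | inj₁ t∈U = t∈U
      ... | inj₂ refl = ⊥-elim (∈C⇒≢root U'∈C t∈U' refl)
      U⊆U' : U ⊆ _
      U⊆U' t∈U with Equivalence.to (bar' _) (U⊆Q t∈U)
      ... | inj₁ t∈U' = t∈U'
      ... | inj₂ v'↝t with OnPath-depth≡1 T len'≡1 v'↝t
      ...   | inj₁ refl = vU∈U U'∈C
      ...   | inj₂ refl = ⊥-elim (∈C⇒≢root U∈C t∈U refl)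

    shallow∈ℳ : (∀ U' → InC-x G x U' → BarEq G T vU U' (U ∪ ⁅ x ⁆) → pLen G T vU U' ≡ 1)
      → InM G T vU U
    shallow∈ℳ W-shallow = U∈C , U ∪ ⁅ x ⁆ , (x∈Q , shallow-∪root-connected) , shallow-closure ,
      λ U' U'∈C bar' t → subst (λ V → OnPath G T (vU V) t)
                           (shallow-closure-injective U'∈C (W-shallow U' U'∈C bar') bar')

  singleton∈C : ∀ {w} → Adj G x w → InC-x G x ⁅ w ⁆
  singleton∈C {w} x~w = (w , x∈⁅x⁆ w) , (λ x∈ → irrefl G (subst (Adj G x) (sym (x∈⁅y⁆⇒x≡y w x∈)) x~w)) ,
    λ u v u∈ v∈ → subst₂ (Walk G (_∈ ⁅ w ⁆)) (sym (x∈⁅y⁆⇒x≡y w u∈)) (sym (x∈⁅y⁆⇒x≡y w v∈)) (here (x∈⁅x⁆ w))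

  pLen-singleton : ∀ {w} → Adj G x w → pLen G T vU ⁅ w ⁆ ≡ 1
  pLen-singleton {w} x~w = pLen≡1 (singleton∈C x~w) (x∈⁅x⁆ w) (neighbour⇒depth≡1 T x~w)

  singleton∈ℳ : ∀ {w} → Adj G x w → InM G T vU ⁅ w ⁆
  singleton∈ℳ {w} x~w = shallow∈ℳ (singleton∈C x~w) (pLen-singleton x~w) W-shallow
    where
    W-shallow : ∀ U' → InC-x G x U' → BarEq G T vU U' (⁅ w ⁆ ∪ ⁅ x ⁆) → pLen G T vU U' ≡ 1
    W-shallow U' U'∈C bar' with ∈∪⁅⁆⁻ (Equivalence.from (bar' _) (inj₁ (vU∈U U'∈C)))
    ... | inj₁ v'∈⁅w⁆ = trans (cong depth (x∈⁅y⁆⇒x≡y w v'∈⁅w⁆)) (neighbour⇒depth≡1 T x~w)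
    ... | inj₂ v'≡x  = ⊥-elim (vU≢root U'∈C v'≡x)

  module _ (partner : Fin n → Fin n)
           (partner-spec : ∀ w → Adj G x w → Adj G x (partner w) × partner w ≢ w) where

    mate : Subset n → Fin n
    mate U = partner (entry T (vU U))

    extension : Subset n → Subset n
    extension U = (U ∪ pathSet T (vU U)) ∪ ⁅ mate U ⁆

    ∈extension⁻ : ∀ {U t} → t ∈ extension U → t ∈ U ⊎ OnPath⁻ T (vU U) t ⊎ t ≡ mate U
    ∈extension⁻ {U} {t} t∈ with x∈p∪q⁻ (U ∪ pathSet T (vU U)) ⁅ mate U ⁆ t∈
    ... | inj₂ t∈⁅a⁆ = inj₂ (inj₂ (x∈⁅y⁆⇒x≡y _ t∈⁅a⁆))
    ... | inj₁ t∈U∪p with x∈p∪q⁻ U (pathSet T (vU U)) t∈U∪p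
    ...   | inj₁ t∈U = inj₁ t∈U
    ...   | inj₂ t∈p = inj₂ (inj₁ (Equivalence.to (∈pathSet⇔ T) t∈p))

    ⊆extension : ∀ {U t} → t ∈ U → t ∈ extension U
    ⊆extension t∈U = x∈p∪q⁺ (inj₁ (x∈p∪q⁺ (inj₁ t∈U)))

    path⊆extension : ∀ {U t} → OnPath⁻ T (vU U) t → t ∈ extension U
    path⊆extension v↝t = x∈p∪q⁺ (inj₁ (x∈p∪q⁺ (inj₂ (Equivalence.from (∈pathSet⇔ T) v↝t))))

    mate∈extension : ∀ {U} → mate U ∈ extension U
    mate∈extension {U} = x∈p∪q⁺ (inj₂ (x∈⁅x⁆ (mate U)))

    module _ {U : Subset n} (U∈C : InC-x G x U) where

      private
        v≢x = vU≢root U∈C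

      entry∈extension : entry T (vU U) ∈ extension U
      entry∈extension = path⊆extension (entry-OnPath T (vU U) , depth≡suc⇒≢root T (depth-entry T v≢x))

      mate-neighbour : Adj G x (mate U)
      mate-neighbour = proj₁ (partner-spec _ (entry-neighbour T v≢x))

      mate≢entry : mate U ≢ entry T (vU U)
      mate≢entry = proj₂ (partner-spec _ (entry-neighbour T v≢x))

      depth-mate : depth (mate U) ≡ 1
      depth-mate = neighbour⇒depth≡1 T mate-neighbour

      mate-off-path : ¬ OnPath G T (vU U) (mate U)
      mate-off-path v↝a = mate≢entry (OnPath-depth-injective T v↝a (entry-OnPath T (vU U))
                                        (trans depth-mate (sym (depth-entry T v≢x))))

      -- The k + 1 vertices of p_U together with mate U are distinct.
      pLen≤n∸2 : pLen G T vU U ≤ n ∸ 2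
      pLen≤n∸2 = m+n≤o⇒m≤o∸n _ (subst (_≤ n) (+-comm 2 _) (injective⇒≤ f-injective))
        where
        k = pLen G T vU U
        f : Fin (2 + k) → Fin n
        f Fin.zero    = mate U
        f (Fin.suc i) = ancestor T (toℕ i) (vU U)
        on-path : ∀ (i : Fin (suc k)) → OnPath G T (vU U) (f (Fin.suc i))
        on-path i = ancestor-OnPath T (toℕ i) (vU U) (toℕ≤pred[n] i)
        depth-f : ∀ (i : Fin (suc k)) → depth (f (Fin.suc i)) ≡ k ∸ toℕ i
        depth-f i = depth-ancestor T (toℕ i) (vU U) (toℕ≤pred[n] i)
        f-injective : ∀ {i j} → f i ≡ f j → i ≡ j
        f-injective {Fin.zero}  {Fin.zero}  _ = refl
        f-injective {Fin.zero}  {Fin.suc j} e = ⊥-elim (mate-off-path (subst (OnPath G T (vU U)) (sym e) (on-path j)))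
        f-injective {Fin.suc i} {Fin.zero}  e = ⊥-elim (mate-off-path (subst (OnPath G T (vU U)) e (on-path i)))
        f-injective {Fin.suc i} {Fin.suc j} e = cong Fin.suc (toℕ-injective
          (∸-cancelˡ-≡ (toℕ≤pred[n] i) (toℕ≤pred[n] j) (trans (sym (depth-f i)) (trans (cong depth e) (depth-f j)))))

    module _ (N[x]-clique : ∀ u v → Adj G x u → Adj G x v → u ≢ v → Adj G u v)
             {U : Subset n} (U∈C : InC-x G x U) where

      private
        v = vU U
        v≢x = vU≢root U∈C
        lift-path : ∀ {t} → OnPath G T v t → ∀ {s} → OnPath⁻ T t s → s ∈ extension U
        lift-path v↝t (t↝s , s≢x) = path⊆extension (OnPath-trans T v↝t t↝s , s≢x)

      extension-connected : ConnectedP G (_∈ extension U)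
      extension-connected = connected-via (entry T v) to-entry
        where
        to-entry : ∀ t → t ∈ extension U → Walk G (_∈ extension U) t (entry T v)
        to-entry t t∈ with ∈extension⁻ t∈
        ... | inj₁ t∈U = walk-map ⊆extension (proj₂ (proj₂ U∈C) t v t∈U (vU∈U U∈C))
                         ++ʷ walk-map (lift-path on-here) (walk-to-entry T v≢x)
        ... | inj₂ (inj₂ refl) =
          step t∈ (N[x]-clique _ _ (mate-neighbour U∈C) (entry-neighbour T v≢x) (mate≢entry U∈C))
            (here (entry∈extension U∈C))
        ... | inj₂ (inj₁ (v↝t , t≢x)) = subst (Walk G (_∈ extension U) t) same-entry
                                          (walk-map (lift-path v↝t) (walk-to-entry T t≢x))
          where
          same-entry : entry T t ≡ entry T v
          same-entry = OnPath-depth-injective T (OnPath-trans T v↝t (entry-OnPath T t)) (entry-OnPath T v)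
                         (trans (depth-entry T t≢x) (sym (depth-entry T v≢x)))

      extension∈C : InC-x G x (extension U)
      extension∈C = (mate U , mate∈extension) , root∉ , extension-connected
        where
        root∉ : x ∉ extension U
        root∉ x∈ with ∈extension⁻ x∈
        ... | inj₁ x∈U = ∈C⇒≢root U∈C x∈U refl
        ... | inj₂ (inj₁ (_ , x≢x)) = x≢x refl
        ... | inj₂ (inj₂ x≡a) = depth≡suc⇒≢root T (depth-mate U∈C) (sym x≡a)

      pLen-extension : pLen G T vU (extension U) ≡ 1
      pLen-extension = pLen≡1 extension∈C (entry∈extension U∈C) (depth-entry T v≢x)

      -- A member of W(extension U ∪ {x}) of pLen at least 2 would have to contain both
      -- depth-1 vertices mate U and entry v on its path.
      extension∈ℳ : InM G T vU (extension U)
      extension∈ℳ = shallow∈ℳ extension∈C pLen-extension W-shallow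
        where
        W-shallow : ∀ U' → InC-x G x U' → BarEq G T vU U' (extension U ∪ ⁅ x ⁆) → pLen G T vU U' ≡ 1
        W-shallow U' U'∈C bar' with pLen G T vU U' ≤? 1
        ... | yes len≤1 = ≤-antisym len≤1 (0<pLen U'∈C)
        ... | no len≰1 = ⊥-elim (mate≢entry U∈C (OnPath-depth-injective T
                           (on-path' mate∈extension (depth-mate U∈C))
                           (on-path' (entry∈extension U∈C) (depth-entry T v≢x))
                           (trans (depth-mate U∈C) (sym (depth-entry T v≢x)))))
          where
          on-path' : ∀ {t} → t ∈ extension U → depth t ≡ 1 → OnPath G T (vU U') t
          on-path' {t} t∈ d≡1 with Equivalence.to (bar' t) (x∈p∪q⁺ (inj₁ t∈))
          ... | inj₂ v'↝t = v'↝t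
          ... | inj₁ t∈U' = ⊥-elim (len≰1 (subst (pLen G T vU U' ≤_) d≡1 (pLen≤depth U'∈C t∈U')))

    module _ {U : Subset n} (U∈C : InC-x G x U) (deep : 2 ≤ pLen G T vU U) where

      deep-member-depth≢1 : ∀ {t} → t ∈ U → depth t ≢ 1
      deep-member-depth≢1 t∈U d≡1 = 1+n≰n (≤-trans deep (subst (pLen G T vU U ≤_) d≡1 (pLen≤depth U∈C t∈U)))

      closure-extension : ∀ t → closure U t ⇔ (t ≡ x ⊎ (t ∈ extension U × t ≢ mate U))
      closure-extension t = mk⇔ to from
        where
        to : closure U t → t ≡ x ⊎ (t ∈ extension U × t ≢ mate U)
        to (inj₁ t∈U) = inj₂ (⊆extension t∈U , λ { refl → deep-member-depth≢1 t∈U (depth-mate U∈C) })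
        to (inj₂ v↝t) with t Fin.≟ x
        ... | yes t≡x = inj₁ t≡x
        ... | no t≢x  = inj₂ (path⊆extension (v↝t , t≢x) , λ { refl → mate-off-path U∈C v↝t })
        from : t ≡ x ⊎ (t ∈ extension U × t ≢ mate U) → closure U t
        from (inj₁ refl) = inj₂ (OnPath-root T (vU U))
        from (inj₂ (t∈ , t≢a)) with ∈extension⁻ t∈
        ... | inj₁ t∈U          = inj₁ t∈U
        ... | inj₂ (inj₁ (v↝t , _)) = inj₂ v↝t
        ... | inj₂ (inj₂ t≡a)   = ⊥-elim (t≢a t≡a)

      extension≢singleton : ∀ {w} → Adj G x w → extension U ≢ ⁅ w ⁆
      extension≢singleton {w} x~w ext≡ = deep-member-depth≢1 (vU∈U U∈C)
        (trans (cong depth (x∈⁅y⁆⇒x≡y w (subst (vU U ∈_) ext≡ (⊆extension (vU∈U U∈C))))) (neighbour⇒depth≡1 T x~w))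

    module _ {U₁ U₂ : Subset n} (U₁∈C : InC-x G x U₁) (U₂∈C : InC-x G x U₂)
             (ext≡ : extension U₁ ≡ extension U₂) where

      private
        v₁ = vU U₁
        v₂ = vU U₂

      module _ (deep₁ : 2 ≤ pLen G T vU U₁) where

        extension≡⇒⊆ : pLen G T vU U₂ ≤ pLen G T vU U₁ → U₁ ⊆ U₂
        extension≡⇒⊆ len₂≤len₁ {t} t∈U₁ with ∈extension⁻ (subst (t ∈_) ext≡ (⊆extension t∈U₁))
        ... | inj₁ t∈U₂ = t∈U₂
        ... | inj₂ (inj₁ (v₂↝t , _)) = subst (_∈ U₂) v₂≡t (vU∈U U₂∈C)
          where
          v₂≡t : v₂ ≡ t
          v₂≡t = OnPath-depth-injective T on-here v₂↝t
                   (≤-antisym (≤-trans len₂≤len₁ (pLen≤depth U₁∈C t∈U₁)) (OnPath-depth≤ T v₂↝t))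
        ... | inj₂ (inj₂ refl) = ⊥-elim (deep-member-depth≢1 U₁∈C deep₁ t∈U₁ (depth-mate U₂∈C))

        private
          y = ancestor T (pLen G T vU U₁ ∸ 2) v₁
          v₁↝y = ancestor-OnPath T (pLen G T vU U₁ ∸ 2) v₁ (m∸n≤m _ 2)
          depth-y : depth y ≡ 2
          depth-y = trans (depth-ancestor T (pLen G T vU U₁ ∸ 2) v₁ (m∸n≤m _ 2)) (m∸[m∸n]≡n deep₁)
          y≢x = depth≡suc⇒≢root T depth-y
          parent≡entry : ∀ {v e} → OnPath G T v y → OnPath G T v e → depth e ≡ 1 → parent y ≡ e
          parent≡entry v↝y v↝e d≡1 = OnPath-depth-injective T (OnPath-parent T v↝y y≢x) v↝e
            (trans (depth-parent T y≢x) (trans (cong (_∸ 1) depth-y) (sym d≡1)))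

        -- The depth-2 vertex y of p_{U₁} lies in extension U₂, but not on p_{U₂}:
        -- its parent is the entry of p_{U₁}.
        extension≡⇒pLen≤2 : entry T v₁ ≢ entry T v₂ → pLen G T vU U₂ ≤ 2
        extension≡⇒pLen≤2 entries≢ with ∈extension⁻ (subst (y ∈_) ext≡ (path⊆extension (v₁↝y , y≢x)))
        ... | inj₁ y∈U₂ = ≤-trans (pLen≤depth U₂∈C y∈U₂) (≤-reflexive depth-y)
        ... | inj₂ (inj₂ y≡a) =
          ⊥-elim (1+n≰n (≤-reflexive (trans (sym depth-y) (trans (cong depth y≡a) (depth-mate U₂∈C)))))
        ... | inj₂ (inj₁ (v₂↝y , _)) = ⊥-elim (entries≢ (trans
              (sym (parent≡entry v₁↝y (entry-OnPath T v₁) (depth-entry T (vU≢root U₁∈C))))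
              (parent≡entry v₂↝y (entry-OnPath T v₂) (depth-entry T (vU≢root U₂∈C)))))

    extension-injective : ∀ {U₁ U₂} → InM G T vU U₁ → InM G T vU U₂
      → 2 ≤ pLen G T vU U₁ → 2 ≤ pLen G T vU U₂ → extension U₁ ≡ extension U₂ → U₁ ≡ U₂
    extension-injective {U₁} {U₂} U₁∈ℳ U₂∈ℳ deep₁ deep₂ ext≡ =
      ⊆-antisym (extension≡⇒⊆ C₁ C₂ ext≡ deep₁ (≤-reflexive (sym len≡)))
                (extension≡⇒⊆ C₂ C₁ (sym ext≡) deep₂ (≤-reflexive len≡))
      where
      C₁ = proj₁ U₁∈ℳ
      C₂ = proj₁ U₂∈ℳ
      len≡ : pLen G T vU U₁ ≡ pLen G T vU U₂
      len≡ with entry T (vU U₁) Fin.≟ entry T (vU U₂)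
      ... | no entries≢ = ≤-antisym
              (≤-trans (extension≡⇒pLen≤2 C₂ C₁ (sym ext≡) deep₂ (≢-sym entries≢)) deep₂)
              (≤-trans (extension≡⇒pLen≤2 C₁ C₂ ext≡ deep₁ entries≢) deep₁)
      ... | yes entries≡ = ≤-antisym (ℳ-pLen-minimal U₂∈ℳ C₁ (⇔.sym ∘ same-closure))
                                     (ℳ-pLen-minimal U₁∈ℳ C₂ same-closure)
        where
        closure₂ : ∀ t → closure U₂ t ⇔ (t ≡ x ⊎ (t ∈ extension U₁ × t ≢ mate U₁))
        closure₂ = subst₂ (λ E a → ∀ t → closure U₂ t ⇔ (t ≡ x ⊎ (t ∈ E × t ≢ a)))
                     (sym ext≡) (cong partner (sym entries≡)) (closure-extension C₂ deep₂)
        same-closure : ∀ t → closure U₁ t ⇔ closure U₂ t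
        same-closure t = ⇔.trans (closure-extension C₁ deep₁ t) (⇔.sym (closure₂ t))

    ℳ-average-bound : (∀ u v → Adj G x u → Adj G x v → u ≢ v → Adj G u v)
      → ∀ {w₀} → Adj G x w₀ → 3 ≤ n → (L : List (Subset n)) → EnumM G T vU L
      → (2 * sum (map (pLen G T vU) L) ≤ (n ∸ 1) * length L)
        × (2 * sum (map (pLen G T vU) L) ≡ (n ∸ 1) * length L → n ≡ 3)
    ℳ-average-bound N[x]-clique {w₀} x~w₀ 3≤n L (L-unique , L-enumerates) =
      subst (λ m → (2 * sum (map len L) ≤ (n ∸ 1) * m) × (2 * sum (map len L) ≡ (n ∸ 1) * m → n ≡ 3))
        (sym (length-filter+filter-∁ deep? L))
        (average-bound n _ _ _ 3≤n sum≤ deep<shallow)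
      where
      len = pLen G T vU
      deep? = λ U → 2 ≤? len U
      Deep = filter deep? L
      Shallow = filter (∁? deep?) L
      ∈ℳ : ∀ {U} → U List.∈ L → InM G T vU U
      ∈ℳ = Equivalence.to (L-enumerates _)
      ∈L : ∀ {U} → InM G T vU U → U List.∈ L
      ∈L = Equivalence.from (L-enumerates _)
      ∈Shallow : ∀ {U} → InM G T vU U → len U ≡ 1 → U List.∈ Shallow
      ∈Shallow U∈ℳ len≡1 = ∈-filter⁺ (∁? deep?) (∈L U∈ℳ) (λ deep → 1+n≰n (subst (2 ≤_) len≡1 deep))
      sum≤ : sum (map len L) ≤ (n ∸ 2) * length Deep + length Shallow
      sum≤ = subst (sum (map len L) ≤_) (cong ((n ∸ 2) * length Deep +_) (*-identityˡ _))
        (sum-≤-filter deep? len L (λ U∈L _ → pLen≤n∸2 (proj₁ (∈ℳ U∈L))) (λ _ ¬deep → s≤s⁻¹ (≰⇒> ¬deep)))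
      deep<shallow : length Deep < length Shallow
      deep<shallow = injection-length< extension (filter⁺ deep? L-unique)
        (λ U∈ → let C = proj₁ (∈ℳ (proj₁ (∈-filter⁻ deep? U∈))) in
           ∈Shallow (extension∈ℳ N[x]-clique C) (pLen-extension N[x]-clique C))
        (λ U₁∈ U₂∈ → let U₁∈L , deep₁ = ∈-filter⁻ deep? U₁∈ ; U₂∈L , deep₂ = ∈-filter⁻ deep? U₂∈ in
           extension-injective (∈ℳ U₁∈L) (∈ℳ U₂∈L) deep₁ deep₂)
        (∈Shallow (singleton∈ℳ x~w₀) (pLen-singleton x~w₀))
        (λ U∈ → let U∈L , deep = ∈-filter⁻ deep? U∈ in extension≢singleton (proj₁ (∈ℳ U∈L)) deep x~w₀)

corollary5p3 : (n : ℕ) (G : Graph n) → ConnectedGraph G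
    → (H : Subset n) → MaximalTwoConnected G H
    → (x : Fin n) → x ∈ H
    → (∀ u → Adj G x u → u ∈ H)
    → (∀ u v → Adj G x u → Adj G x v → u ≢ v → Adj G u v)
    → (T : SDTree G x) (vU : Subset n → Fin n) → ClosestChoice G T vU
    → (L : List (Subset n)) → EnumM G T vU L
    → (2 * sum (map (pLen G T vU) L) ≤ (n ∸ 1) * length L)
    × ((2 * sum (map (pLen G T vU) L) ≡ (n ∸ 1) * length L) ⇔ IsK3 G)
corollary5p3 n G _ H (H-2conn , _) x x∈H N[x]⊆H N[x]-clique T vU closest L L-enum
  with w₀ , x~w₀ ← block-neighbour G H-2conn x∈H
     | partner , partner-spec ← block-partner G H-2conn x∈H N[x]⊆H
  = proj₁ bound , mk⇔ tight⇒K3 K3⇒tight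
  where
  bound = ℳ-average-bound T closest partner partner-spec N[x]-clique x~w₀
            (≤-trans (proj₁ H-2conn) (∣p∣≤n H)) L L-enum
  tight⇒K3 : 2 * sum (map (pLen G T vU) L) ≡ (n ∸ 1) * length L → IsK3 G
  tight⇒K3 tight with x~a₀ , a₀≢w₀ ← partner-spec w₀ x~w₀ =
    triangle⇒K3 G (proj₂ bound tight) x~w₀ x~a₀ (N[x]-clique _ _ x~w₀ x~a₀ (≢-sym a₀≢w₀))
  -- In K₃ every connected set avoiding x is at distance 1 from x.
  K3⇒tight : IsK3 G → 2 * sum (map (pLen G T vU) L) ≡ (n ∸ 1) * length L
  K3⇒tight (refl , complete) = cong (2 *_) (sum-map-≡1 (pLen G T vU) L λ U∈L →
    neighbour⇒depth≡1 T (complete x _ (≢-sym (vU≢root T closest (proj₁ (Equivalence.to (proj₂ L-enum _) U∈L))))))
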